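{- For every admissible $n$ (that is, every integer $n\ge 6$ with $n\equiv 0$ or $1 \pmod 3$), there exists an equitably $2$-chromatic $3$-star system of order $n$.
   Context: An $e$-star is the complete bipartite graph $K_{1,e}$. An $e$-star system of order $n$ is a pair $(V,\mathcal B)$ where $|V|=n$ and $\mathcal B$ is a set of $e$-stars (subgraphs of the complete graph $K_n$ on $V$) whose edge sets partition the edge set of $K_n$. An $e$-star system is $k$-colourable if $V$ can be partitioned into $k$ sets (colour classes) such that no star in $\mathcal B$ has all its $e+1$ vertices in the same class; it is $k$-chromatic if it is $k$-colourable but not $(k-1)$-colourable. A colouring is equitable if the sizes of the colour classes differ by at most one. An $e$-star system is equitably $k$-chromatic if it is $k$-chromatic and admits an equitable $k$-colouring. A $3$-star system of order $n$ exists if and only if $n\equiv 0,1 \pmod 3$ and $n\ge 6$; such $n$ are called admissible. -}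

module Defs where

open import Data.Nat using (ℕ; zero; suc; _+_; _≤_; _%_)
open import Data.Fin using (Fin)
open import Data.Fin.Properties using (_≟_)
open import Data.List using (List; []; _∷_; length; filter; map; allFin)
open import Data.Nat.ListAction using (sum)
open import Data.Product using (Σ; _×_; _,_; ∃)
open import Relation.Binary.PropositionalEquality using (_≡_; _≢_)
open import Relation.Nullary using (¬_; yes; no)
open import Data.Bool using (Bool; true; false; _∧_; _∨_)
open import Relation.Nullary.Decidable using (⌊_⌋)

-- A 3-star K_{1,3} on vertex set Fin n: a centre and three leaves,
-- all four vertices pairwise distinct. (Leaves are an ordered triple;
-- the star as a subgraph is the set of edges {centre,leafᵢ}.)
record Star3 (n : ℕ) : Set where
  constructor star
  field
    centre : Fin n
    leaf₁ leaf₂ leaf₃ : Fin n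
    c≢1 : centre ≢ leaf₁
    c≢2 : centre ≢ leaf₂
    c≢3 : centre ≢ leaf₃
    1≢2 : leaf₁ ≢ leaf₂
    1≢3 : leaf₁ ≢ leaf₃
    2≢3 : leaf₂ ≢ leaf₃
open Star3 public

vertices : ∀ {n} → Star3 n → List (Fin n)
vertices s = centre s ∷ leaf₁ s ∷ leaf₂ s ∷ leaf₃ s ∷ []

sameEdge : ∀ {n} → Fin n → Fin n → Fin n → Fin n → Bool
sameEdge c l x y = (⌊ c ≟ x ⌋ ∧ ⌊ l ≟ y ⌋) ∨ (⌊ c ≟ y ⌋ ∧ ⌊ l ≟ x ⌋)

b2n : Bool → ℕ
b2n true = 1
b2n false = 0

edgeCount : ∀ {n} → Star3 n → Fin n → Fin n → ℕ
edgeCount s x y =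
  b2n (sameEdge (centre s) (leaf₁ s) x y) +
  (b2n (sameEdge (centre s) (leaf₂ s) x y) +
   b2n (sameEdge (centre s) (leaf₃ s) x y))

multiplicity : ∀ {n} → List (Star3 n) → Fin n → Fin n → ℕ
multiplicity B x y = sum (map (λ s → edgeCount s x y) B)

-- A 3-star system of order n: a collection of 3-stars in K_n whose
-- edge sets partition E(K_n), i.e. every edge {x,y} (x ≢ y) lies in
-- exactly one edge of exactly one star (counted with multiplicity, so
-- the list has no repeated stars and stars are edge-disjoint).
IsStarSystem : (n : ℕ) → List (Star3 n) → Set
IsStarSystem n B = (x y : Fin n) → x ≢ y → multiplicity B x y ≡ 1

Monochromatic : ∀ {n k} → (Fin n → Fin k) → Star3 n → Set
Monochromatic f s =
  (f (centre s) ≡ f (leaf₁ s)) × (f (centre s) ≡ f (leaf₂ s)) × (f (centre s) ≡ f (leaf₃ s))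

IsColouring : ∀ {n} (k : ℕ) → List (Star3 n) → (Fin n → Fin k) → Set
IsColouring {n} k B f = ∀ s → s ∈ B → ¬ Monochromatic f s
  where open import Data.List.Membership.Propositional using (_∈_)

Colourable : ∀ {n} (k : ℕ) → List (Star3 n) → Set
Colourable k B = Σ (_ → Fin k) (IsColouring k B)

Chromatic : ∀ {n} (k : ℕ) → List (Star3 n) → Set
Chromatic zero B = Colourable zero B
Chromatic (suc k) B = Colourable (suc k) B × ¬ Colourable k B

classSize : ∀ {n k} → (Fin n → Fin k) → Fin k → ℕ
classSize {n} f i = length (filter (λ v → f v ≟ i) (allFin n))

Equitable : ∀ {n k} → (Fin n → Fin k) → Set
Equitable {k = k} f = (i j : Fin k) → classSize f i ≤ suc (classSize f j)

EquitablyChromatic : ∀ {n} (k : ℕ) → List (Star3 n) → Set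
EquitablyChromatic k B =
  Chromatic k B × Σ (_ → Fin k) (λ f → IsColouring k B f × Equitable f)

-- Colour each vertex by the parity of its index. Orders 6 and 7 are settled by explicit
-- systems, checked by evaluation. A system of order n ≥ 2 extends to one of order n + 3:
-- shift the old vertices up by three and add new vertices 0, 1, 2; three "spokes" centred at
-- the new vertices cover the triangle on them together with their edges to the old vertices
-- 0 and 1, and every other old vertex is the centre of a "fan" onto the three new vertices.
-- Shifting by three flips parities, so shifted stars stay bichromatic, and each new star
-- contains two vertices of different parity. The parity colouring is equitable, and a star
-- system is never 1-colourable because it contains a star.
module Submission where

open import Defs
open import Data.Bool using (true; false; _∧_; _∨_)
open import Data.Bool.Properties using (∧-zeroʳ; ∧-identityʳ; ∨-comm)
open import Data.Empty using (⊥-elim)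
open import Data.Fin using (Fin; zero; suc; _↑ˡ_; _↑ʳ_; #_; opposite)
open import Data.Fin.Properties
  using (_≟_; all?; ↑ʳ-injective; suc-injective; opposite-involutive)
open import Data.List using (List; []; _∷_; map; _++_; allFin; filter; length; tabulate)
open import Data.List.Membership.Propositional using (_∈_; _∉_)
open import Data.List.Membership.Propositional.Properties using (∈-map⁻; ∈-++⁻)
open import Data.List.Properties using (map-++; map-tabulate; tabulate-cong)
import Data.List.Relation.Unary.All as All
open import Data.List.Relation.Unary.Any using (here; there)
open import Data.Nat using (ℕ; zero; suc; _+_; _≤_; _%_; z≤n; s≤s)
import Data.Nat as ℕ
open import Data.Nat.ListAction using (sum)
open import Data.Nat.ListAction.Properties using (sum-++)
open import Data.Nat.Properties using (+-identityʳ; ≤-trans; n≤1+n; m≤n⇒m≤1+n; ≤-reflexive)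
open import Data.Product using (Σ; _×_; _,_)
open import Data.Sum using (_⊎_; inj₁; inj₂)
import Data.Sum as Sum
open import Function using (_∘_; Injective)
open import Relation.Binary.PropositionalEquality
open import Relation.Unary using (Decidable)
open import Relation.Nullary using (Dec; ¬_; yes; no; ¬?; _×-dec_; _→-dec_)
open import Relation.Nullary.Decidable
  using (⌊_⌋; False; map′; from-yes; toWitnessFalse; isYes≗does; dec-false; dec-true)

private variable
  n : ℕ

isYes-false : ∀ {a} {A : Set a} (a? : Dec A) → ¬ A → ⌊ a? ⌋ ≡ false
isYes-false a? ¬a = trans (isYes≗does a?) (dec-false a? ¬a)

isYes-true : ∀ {a} {A : Set a} (a? : Dec A) → A → ⌊ a? ⌋ ≡ true
isYes-true a? a = trans (isYes≗does a?) (dec-true a? a)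

⌊≟⌋-injective : ∀ {m} {ρ : Fin m → Fin n} → Injective _≡_ _≡_ ρ →
  ∀ a b → ⌊ ρ a ≟ ρ b ⌋ ≡ ⌊ a ≟ b ⌋
⌊≟⌋-injective {ρ = ρ} ρ-inj a b with ρ a ≟ ρ b | a ≟ b
... | yes _   | yes _   = refl
... | no _    | no _    = refl
... | yes ρa≡ρb | no a≢b = ⊥-elim (a≢b (ρ-inj ρa≡ρb))
... | no ρa≢ρb | yes refl = ⊥-elim (ρa≢ρb refl)

mkStar : (c l₁ l₂ l₃ : Fin n) →
  {False (c ≟ l₁)} → {False (c ≟ l₂)} → {False (c ≟ l₃)} →
  {False (l₁ ≟ l₂)} → {False (l₁ ≟ l₃)} → {False (l₂ ≟ l₃)} → Star3 n
mkStar c l₁ l₂ l₃ {c≢1} {c≢2} {c≢3} {1≢2} {1≢3} {2≢3} =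
  star c l₁ l₂ l₃ (toWitnessFalse c≢1) (toWitnessFalse c≢2) (toWitnessFalse c≢3)
    (toWitnessFalse 1≢2) (toWitnessFalse 1≢3) (toWitnessFalse 2≢3)

rename : ∀ {m} (ρ : Fin m → Fin n) → Injective _≡_ _≡_ ρ → Star3 m → Star3 n
rename ρ ρ-inj s = star (ρ (centre s)) (ρ (leaf₁ s)) (ρ (leaf₂ s)) (ρ (leaf₃ s))
  (c≢1 s ∘ ρ-inj) (c≢2 s ∘ ρ-inj) (c≢3 s ∘ ρ-inj)
  (1≢2 s ∘ ρ-inj) (1≢3 s ∘ ρ-inj) (2≢3 s ∘ ρ-inj)

leaves : Star3 n → List (Fin n)
leaves s = leaf₁ s ∷ leaf₂ s ∷ leaf₃ s ∷ []

∉-leaves : ∀ {s : Star3 n} {x} → leaf₁ s ≢ x → leaf₂ s ≢ x → leaf₃ s ≢ x → x ∉ leaves s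
∉-leaves 1≢x _ _ (here refl) = 1≢x refl
∉-leaves _ 2≢x _ (there (here refl)) = 2≢x refl
∉-leaves _ _ 3≢x (there (there (here refl))) = 3≢x refl

sameEdge-sym : (c l x y : Fin n) → sameEdge c l x y ≡ sameEdge c l y x
sameEdge-sym c l x y = ∨-comm (⌊ c ≟ x ⌋ ∧ ⌊ l ≟ y ⌋) (⌊ c ≟ y ⌋ ∧ ⌊ l ≟ x ⌋)

sameEdge-false : ∀ {c l x y : Fin n} → c ≢ x ⊎ l ≢ y → c ≢ y ⊎ l ≢ x →
  sameEdge c l x y ≡ false
sameEdge-false {c = c} {l} {x} {y} hx hy =
  cong₂ _∨_ (∧-false (c ≟ x) (l ≟ y) hx) (∧-false (c ≟ y) (l ≟ x) hy)
  where
  ∧-false : ∀ {A B : Set} (a? : Dec A) (b? : Dec B) → ¬ A ⊎ ¬ B → ⌊ a? ⌋ ∧ ⌊ b? ⌋ ≡ false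
  ∧-false a? b? (inj₁ ¬a) = cong (_∧ ⌊ b? ⌋) (isYes-false a? ¬a)
  ∧-false a? b? (inj₂ ¬b) =
    trans (cong (⌊ a? ⌋ ∧_) (isYes-false b? ¬b)) (∧-zeroʳ ⌊ a? ⌋)

sameEdge-leaf : ∀ {c l : Fin n} → c ≢ l → ∀ y → sameEdge c l l y ≡ ⌊ c ≟ y ⌋
sameEdge-leaf {c = c} {l} c≢l y
  rewrite isYes-false (c ≟ l) c≢l | isYes-true (l ≟ l) refl = ∧-identityʳ ⌊ c ≟ y ⌋

sameEdge-rename : ∀ {m} {ρ : Fin m → Fin n} (ρ-inj : Injective _≡_ _≡_ ρ)
  (c l x y : Fin m) →
  sameEdge (ρ c) (ρ l) (ρ x) (ρ y) ≡ sameEdge c l x y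
sameEdge-rename ρ-inj c l x y =
  cong₂ _∨_ (cong₂ _∧_ (inj c x) (inj l y)) (cong₂ _∧_ (inj c y) (inj l x))
  where inj = ⌊≟⌋-injective ρ-inj

edgeCount-sym : (s : Star3 n) (x y : Fin n) → edgeCount s x y ≡ edgeCount s y x
edgeCount-sym s x y =
  cong₂ _+_ (count (leaf₁ s)) (cong₂ _+_ (count (leaf₂ s)) (count (leaf₃ s)))
  where count = λ l → cong b2n (sameEdge-sym (centre s) l x y)

edgeCount-rename : ∀ {m} {ρ : Fin m → Fin n} (ρ-inj : Injective _≡_ _≡_ ρ)
  (s : Star3 m) (x y : Fin m) →
  edgeCount (rename ρ ρ-inj s) (ρ x) (ρ y) ≡ edgeCount s x y
edgeCount-rename ρ-inj s x y =
  cong₂ _+_ (count (leaf₁ s)) (cong₂ _+_ (count (leaf₂ s)) (count (leaf₃ s)))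
  where count = λ l → cong b2n (sameEdge-rename ρ-inj (centre s) l x y)

-- Edges of a star join its centre to a leaf; the hypotheses rule out both orientations of {x, y}.
edgeCount-≡0 : ∀ (s : Star3 n) {x y} →
  centre s ≢ x ⊎ y ∉ leaves s → centre s ≢ y ⊎ x ∉ leaves s → edgeCount s x y ≡ 0
edgeCount-≡0 s hx hy =
  cong₂ _+_ (count (here refl))
            (cong₂ _+_ (count (there (here refl))) (count (there (there (here refl)))))
  where
  notLeaf : ∀ {l z} → l ∈ leaves s → z ∉ leaves s → l ≢ z
  notLeaf l∈ z∉ refl = z∉ l∈
  count : ∀ {l} → l ∈ leaves s → b2n (sameEdge (centre s) l _ _) ≡ 0
  count l∈ =
    cong b2n (sameEdge-false (Sum.map₂ (notLeaf l∈) hx) (Sum.map₂ (notLeaf l∈) hy))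

leaf : Star3 n → Fin 3 → Fin n
leaf s zero = leaf₁ s
leaf s (suc zero) = leaf₂ s
leaf s (suc (suc zero)) = leaf₃ s

b2n-sameEdge-≢ : ∀ {c l x : Fin n} y → c ≢ x → l ≢ x → b2n (sameEdge c l x y) ≡ 0
b2n-sameEdge-≢ y c≢x l≢x = cong b2n (sameEdge-false (inj₁ c≢x) (inj₂ l≢x))

edgeCount-leaf : ∀ (s : Star3 n) k y → edgeCount s (leaf s k) y ≡ b2n ⌊ centre s ≟ y ⌋
edgeCount-leaf s zero y = trans
  (cong₂ _+_ (cong b2n (sameEdge-leaf (c≢1 s) y))
             (cong₂ _+_ (b2n-sameEdge-≢ y (c≢1 s) (1≢2 s ∘ sym))
                        (b2n-sameEdge-≢ y (c≢1 s) (1≢3 s ∘ sym))))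
  (+-identityʳ _)
edgeCount-leaf s (suc zero) y = trans
  (cong₂ _+_ (b2n-sameEdge-≢ y (c≢2 s) (1≢2 s))
             (cong₂ _+_ (cong b2n (sameEdge-leaf (c≢2 s) y))
                        (b2n-sameEdge-≢ y (c≢2 s) (2≢3 s ∘ sym))))
  (+-identityʳ _)
edgeCount-leaf s (suc (suc zero)) y =
  cong₂ _+_ (b2n-sameEdge-≢ y (c≢3 s) (1≢3 s))
            (cong₂ _+_ (b2n-sameEdge-≢ y (c≢3 s) (2≢3 s))
                       (cong b2n (sameEdge-leaf (c≢3 s) y)))

multiplicity-++ : (A B : List (Star3 n)) (x y : Fin n) →
  multiplicity (A ++ B) x y ≡ multiplicity A x y + multiplicity B x y
multiplicity-++ A B x y = trans (cong sum (map-++ count A B)) (sum-++ (map count A) (map count B))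
  where count = λ s → edgeCount s x y

multiplicity-sym : (B : List (Star3 n)) (x y : Fin n) → multiplicity B x y ≡ multiplicity B y x
multiplicity-sym [] x y = refl
multiplicity-sym (s ∷ B) x y = cong₂ _+_ (edgeCount-sym s x y) (multiplicity-sym B x y)

multiplicity-map : ∀ {A : Set} (f : A → Star3 n) (g : A → ℕ) (as : List A) {x y} →
  (∀ a → edgeCount (f a) x y ≡ g a) → multiplicity (map f as) x y ≡ sum (map g as)
multiplicity-map f g [] eq = refl
multiplicity-map f g (a ∷ as) eq = cong₂ _+_ (eq a) (multiplicity-map f g as eq)

multiplicity-map-≡0 : ∀ {A : Set} (f : A → Star3 n) (as : List A) {x y} →
  (∀ a → edgeCount (f a) x y ≡ 0) → multiplicity (map f as) x y ≡ 0
multiplicity-map-≡0 f [] eq = refl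
multiplicity-map-≡0 f (a ∷ as) eq = cong₂ _+_ (eq a) (multiplicity-map-≡0 f as eq)

multiplicity-rename : ∀ {m} {ρ : Fin m → Fin n} (ρ-inj : Injective _≡_ _≡_ ρ)
  (B : List (Star3 m)) x y →
  multiplicity (map (rename ρ ρ-inj) B) (ρ x) (ρ y) ≡ multiplicity B x y
multiplicity-rename ρ-inj [] x y = refl
multiplicity-rename ρ-inj (s ∷ B) x y =
  cong₂ _+_ (edgeCount-rename ρ-inj s x y) (multiplicity-rename ρ-inj B x y)

sum-zeros : ∀ m → sum (tabulate {n = m} (λ _ → 0)) ≡ 0
sum-zeros zero = refl
sum-zeros (suc m) = sum-zeros m

sum-indicator : ∀ {m} (j : Fin m) → sum (tabulate (λ i → b2n ⌊ i ≟ j ⌋)) ≡ 1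
sum-indicator {suc m} zero = cong suc (sum-zeros m)
sum-indicator {suc m} (suc j) =
  trans (cong sum (tabulate-cong (λ i → cong b2n (⌊≟⌋-injective suc-injective i j))))
        (sum-indicator j)

parity : Fin n → Fin 2
parity zero = zero
parity (suc zero) = suc zero
parity (suc (suc v)) = parity v

parity-suc : (v : Fin n) → parity (suc v) ≡ opposite (parity v)
parity-suc zero = refl
parity-suc (suc zero) = refl
parity-suc (suc (suc v)) = parity-suc v

parity-suc-reflects : (a b : Fin n) → parity (suc a) ≡ parity (suc b) → parity a ≡ parity b
parity-suc-reflects a b eq = begin
  parity a                        ≡⟨ opposite-involutive (parity a) ⟨
  opposite (opposite (parity a))  ≡⟨ cong opposite (parity-suc a) ⟨
  opposite (parity (suc a))       ≡⟨ cong opposite eq ⟩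
  opposite (parity (suc b))       ≡⟨ cong opposite (parity-suc b) ⟩
  opposite (opposite (parity b))  ≡⟨ opposite-involutive (parity b) ⟩
  parity b                        ∎
  where open ≡-Reasoning

monochromatic-map : ∀ {k} {f g : Fin n → Fin k} {s : Star3 n} →
  (∀ a b → f a ≡ f b → g a ≡ g b) → Monochromatic f s → Monochromatic g s
monochromatic-map reflects (e₁ , e₂ , e₃) =
  reflects _ _ e₁ , reflects _ _ e₂ , reflects _ _ e₃

starSystem⇒¬1-colourable : {B : List (Star3 (suc (suc n)))} →
  IsStarSystem (suc (suc n)) B → ¬ Colourable 1 B
starSystem⇒¬1-colourable {B = []} isSys _ with isSys zero (suc zero) (λ ())
... | ()
starSystem⇒¬1-colourable {B = s ∷ _} _ (f , proper) =
  proper s (here refl) (Fin1-≡ _ _ , Fin1-≡ _ _ , Fin1-≡ _ _)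
  where
  Fin1-≡ : (a b : Fin 1) → a ≡ b
  Fin1-≡ zero zero = refl

length-filter : ∀ {A : Set} {P : A → Set} (P? : Decidable P) (xs : List A) →
  length (filter P? xs) ≡ sum (map (λ x → b2n ⌊ P? x ⌋) xs)
length-filter P? [] = refl
length-filter P? (x ∷ xs) with P? x
... | yes _ = cong suc (length-filter P? xs)
... | no _ = length-filter P? xs

classSize-≡-sum : ∀ {k} (f : Fin n → Fin k) i →
  classSize f i ≡ sum (tabulate (λ v → b2n ⌊ f v ≟ i ⌋))
classSize-≡-sum f i = trans (length-filter (λ v → f v ≟ i) (allFin _))
  (cong sum (map-tabulate (λ v → v) (λ v → b2n ⌊ f v ≟ i ⌋)))

-- By computation on the indicator sums: vertices 0 and 1 add one to each class, and
-- parity (2 + v) = parity v.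
classSize-parity-suc² : ∀ n i → classSize (parity {suc (suc n)}) i ≡ suc (classSize (parity {n}) i)
classSize-parity-suc² n zero = trans (classSize-≡-sum (parity {suc (suc n)}) zero)
  (cong suc (sym (classSize-≡-sum (parity {n}) zero)))
classSize-parity-suc² n (suc zero) = trans (classSize-≡-sum (parity {suc (suc n)}) (suc zero))
  (cong suc (sym (classSize-≡-sum (parity {n}) (suc zero))))

parity-balanced : ∀ n → classSize (parity {n}) zero ≡ classSize (parity {n}) (suc zero)
                      ⊎ classSize (parity {n}) zero ≡ suc (classSize (parity {n}) (suc zero))
parity-balanced zero = inj₁ refl
parity-balanced (suc zero) = inj₂ refl
parity-balanced (suc (suc n))
  rewrite classSize-parity-suc² n zero | classSize-parity-suc² n (suc zero)
  with parity-balanced n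
... | inj₁ eq = inj₁ (cong suc eq)
... | inj₂ eq = inj₂ (cong suc eq)

parity-equitable : ∀ n → Equitable (parity {n})
parity-equitable n zero zero = n≤1+n _
parity-equitable n (suc zero) (suc zero) = n≤1+n _
parity-equitable n zero (suc zero) with parity-balanced n
... | inj₁ eq = m≤n⇒m≤1+n (≤-reflexive eq)
... | inj₂ eq = ≤-reflexive eq
parity-equitable n (suc zero) zero with parity-balanced n
... | inj₁ eq = m≤n⇒m≤1+n (≤-reflexive (sym eq))
... | inj₂ eq = m≤n⇒m≤1+n (≤-trans (n≤1+n _) (≤-reflexive (sym eq)))

monochromatic? : ∀ {k} (f : Fin n → Fin k) (s : Star3 n) → Dec (Monochromatic f s)
monochromatic? f s =
  f (centre s) ≟ f (leaf₁ s) ×-dec f (centre s) ≟ f (leaf₂ s) ×-dec f (centre s) ≟ f (leaf₃ s)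

isColouring? : ∀ {k} (B : List (Star3 n)) (f : Fin n → Fin k) → Dec (IsColouring k B f)
isColouring? B f = map′ (λ proper s → All.lookup proper) (λ proper → All.tabulate (proper _))
  (All.all? (¬? ∘ monochromatic? f) B)

isStarSystem? : ∀ n (B : List (Star3 n)) → Dec (IsStarSystem n B)
isStarSystem? n B = all? λ x → all? λ y → ¬? (x ≟ y) →-dec multiplicity B x y ℕ.≟ 1

ParityColouredSystem : ℕ → Set
ParityColouredSystem n = Σ (List (Star3 n)) λ B → IsStarSystem n B × IsColouring 2 B parity

system₆ : ParityColouredSystem 6
system₆ = B , from-yes (isStarSystem? 6 B) , from-yes (isColouring? B parity)
  where
  B : List (Star3 6)
  B = mkStar (# 0) (# 1) (# 2) (# 3) ∷ mkStar (# 4) (# 0) (# 1) (# 2)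
    ∷ mkStar (# 5) (# 0) (# 1) (# 4) ∷ mkStar (# 2) (# 1) (# 3) (# 5)
    ∷ mkStar (# 3) (# 1) (# 4) (# 5) ∷ []

system₇ : ParityColouredSystem 7
system₇ = B , from-yes (isStarSystem? 7 B) , from-yes (isColouring? B parity)
  where
  B : List (Star3 7)
  B = mkStar (# 0) (# 1) (# 2) (# 3) ∷ mkStar (# 0) (# 4) (# 5) (# 6)
    ∷ mkStar (# 1) (# 2) (# 3) (# 4) ∷ mkStar (# 5) (# 1) (# 2) (# 3)
    ∷ mkStar (# 6) (# 1) (# 2) (# 5) ∷ mkStar (# 3) (# 2) (# 4) (# 6)
    ∷ mkStar (# 4) (# 2) (# 5) (# 6) ∷ []

module Extension {m : ℕ} where

  old : Fin (2 + m) → Fin (5 + m)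
  old = 3 ↑ʳ_

  new : Fin 3 → Fin (5 + m)
  new k = k ↑ˡ (2 + m)

  old≢new : ∀ v k → old v ≢ new k
  old≢new v zero ()
  old≢new v (suc zero) ()
  old≢new v (suc (suc zero)) ()

  data Side : Fin (5 + m) → Set where
    isNew : ∀ k → Side (new k)
    isOld : ∀ v → Side (old v)

  side : ∀ x → Side x
  side zero = isNew (# 0)
  side (suc zero) = isNew (# 1)
  side (suc (suc zero)) = isNew (# 2)
  side (suc (suc (suc v))) = isOld v

  shift : Star3 (2 + m) → Star3 (5 + m)
  shift = rename old (↑ʳ-injective 3 _ _)

  spokes : List (Star3 (5 + m))
  spokes = mkStar (new (# 0)) (new (# 1)) (old (# 0)) (old (# 1))
         ∷ mkStar (new (# 1)) (new (# 2)) (old (# 0)) (old (# 1))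
         ∷ mkStar (new (# 2)) (new (# 0)) (old (# 0)) (old (# 1)) ∷ []

  fan : Fin m → Star3 (5 + m)
  fan i = mkStar (old (suc (suc i))) (new (# 0)) (new (# 1)) (new (# 2))

  fans : List (Star3 (5 + m))
  fans = map fan (allFin m)

  extend : List (Star3 (2 + m)) → List (Star3 (5 + m))
  extend B = map shift B ++ spokes ++ fans

  fan-leaf : ∀ i k → leaf (fan i) k ≡ new k
  fan-leaf i zero = refl
  fan-leaf i (suc zero) = refl
  fan-leaf i (suc (suc zero)) = refl

  fans-vanish : ∀ {x y} → (∀ i → edgeCount (fan i) x y ≡ 0) → multiplicity fans x y ≡ 0
  fans-vanish = multiplicity-map-≡0 fan (allFin m)

  fans-new-old : ∀ k j → multiplicity fans (new k) (old (suc (suc j))) ≡ 1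
  fans-new-old k j = begin
    multiplicity fans (new k) (old (suc (suc j)))  ≡⟨ multiplicity-map fan indicator (allFin m) count ⟩
    sum (map indicator (allFin m))                 ≡⟨ cong sum (map-tabulate (λ i → i) indicator) ⟩
    sum (tabulate indicator)                       ≡⟨ sum-indicator j ⟩
    1                                              ∎
    where
    open ≡-Reasoning
    indicator : Fin m → ℕ
    indicator i = b2n ⌊ i ≟ j ⌋
    count : ∀ i → edgeCount (fan i) (new k) (old (suc (suc j))) ≡ indicator i
    count i = begin
      edgeCount (fan i) (new k) (old (suc (suc j)))
        ≡⟨ cong (λ x → edgeCount (fan i) x _) (fan-leaf i k) ⟨
      edgeCount (fan i) (leaf (fan i) k) (old (suc (suc j)))
        ≡⟨ edgeCount-leaf (fan i) k _ ⟩
      b2n ⌊ 5 ↑ʳ i ≟ 5 ↑ʳ j ⌋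
        ≡⟨ cong b2n (⌊≟⌋-injective (↑ʳ-injective 5 _ _) i j) ⟩
      indicator i
        ∎

  shifted-new : ∀ B k y → multiplicity (map shift B) (new k) y ≡ 0
  shifted-new B k y = multiplicity-map-≡0 shift B λ s →
    edgeCount-≡0 (shift s) (inj₁ (old≢new _ k))
      (inj₂ (∉-leaves {s = shift s} (old≢new _ k) (old≢new _ k) (old≢new _ k)))

  extend-new-new : ∀ B k k′ → k ≢ k′ → multiplicity (extend B) (new k) (new k′) ≡ 1
  extend-new-new B k k′ k≢k′ = trans (multiplicity-++ (map shift B) _ _ _)
    (cong₂ _+_ (shifted-new B k _) (spokes-new-new k k′ k≢k′))
    where
    spokes-new-new : ∀ k k′ → k ≢ k′ → multiplicity (spokes ++ fans) (new k) (new k′) ≡ 1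
    spokes-new-new zero zero k≢k′ = ⊥-elim (k≢k′ refl)
    spokes-new-new zero (suc zero) _ = cong suc (fans-vanish λ _ → refl)
    spokes-new-new zero (suc (suc zero)) _ = cong suc (fans-vanish λ _ → refl)
    spokes-new-new (suc zero) zero _ = cong suc (fans-vanish λ _ → refl)
    spokes-new-new (suc zero) (suc zero) k≢k′ = ⊥-elim (k≢k′ refl)
    spokes-new-new (suc zero) (suc (suc zero)) _ = cong suc (fans-vanish λ _ → refl)
    spokes-new-new (suc (suc zero)) zero _ = cong suc (fans-vanish λ _ → refl)
    spokes-new-new (suc (suc zero)) (suc zero) _ = cong suc (fans-vanish λ _ → refl)
    spokes-new-new (suc (suc zero)) (suc (suc zero)) k≢k′ = ⊥-elim (k≢k′ refl)

  extend-new-old : ∀ B k v → multiplicity (extend B) (new k) (old v) ≡ 1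
  extend-new-old B k v = trans (multiplicity-++ (map shift B) _ _ _)
    (cong₂ _+_ (shifted-new B k _) (spokes-new-old k v))
    where
    spokes-new-old : ∀ k v → multiplicity (spokes ++ fans) (new k) (old v) ≡ 1
    spokes-new-old zero zero = cong suc (fans-vanish λ _ → refl)
    spokes-new-old zero (suc zero) = cong suc (fans-vanish λ _ → refl)
    spokes-new-old (suc zero) zero = cong suc (fans-vanish λ _ → refl)
    spokes-new-old (suc zero) (suc zero) = cong suc (fans-vanish λ _ → refl)
    spokes-new-old (suc (suc zero)) zero = cong suc (fans-vanish λ _ → refl)
    spokes-new-old (suc (suc zero)) (suc zero) = cong suc (fans-vanish λ _ → refl)
    spokes-new-old zero (suc (suc j)) = fans-new-old zero j
    spokes-new-old (suc zero) (suc (suc j)) = fans-new-old (suc zero) j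
    spokes-new-old (suc (suc zero)) (suc (suc j)) = fans-new-old (suc (suc zero)) j

  extend-old-old : ∀ {B} → IsStarSystem (2 + m) B →
    ∀ u v → u ≢ v → multiplicity (extend B) (old u) (old v) ≡ 1
  extend-old-old {B} isSys u v u≢v = trans (multiplicity-++ (map shift B) _ _ _)
    (cong₂ _+_ (trans (multiplicity-rename (↑ʳ-injective 3 _ _) B u v) (isSys u v u≢v))
               fans-old-old)
    where
    outside : ∀ i w → old w ∉ leaves (fan i)
    outside i w = ∉-leaves {s = fan i} {x = old w} (λ ()) (λ ()) (λ ())
    fans-old-old : multiplicity fans (old u) (old v) ≡ 0
    fans-old-old =
      fans-vanish λ i → edgeCount-≡0 (fan i) (inj₂ (outside i v)) (inj₂ (outside i u))

  extend-isStarSystem : ∀ {B} → IsStarSystem (2 + m) B → IsStarSystem (5 + m) (extend B)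
  extend-isStarSystem {B} isSys x y x≢y with side x | side y
  ... | isNew k | isNew k′ = extend-new-new B k k′ (x≢y ∘ cong new)
  ... | isNew k | isOld v  = extend-new-old B k v
  ... | isOld u | isNew k  =
    trans (multiplicity-sym (extend B) (old u) (new k)) (extend-new-old B k u)
  ... | isOld u | isOld v  = extend-old-old {B} isSys u v (x≢y ∘ cong old)

  extend-proper : ∀ {B} → IsColouring 2 B parity → IsColouring 2 (extend B) parity
  extend-proper {B} proper s s∈ with ∈-++⁻ (map shift B) s∈
  ... | inj₁ s∈shifted with ∈-map⁻ shift s∈shifted
  ...   | s′ , s′∈B , refl =
    proper s′ s′∈B ∘ monochromatic-map {f = parity ∘ old} {s = s′} parity-suc-reflects
  extend-proper proper s s∈ | inj₂ (here refl) = λ ()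
  extend-proper proper s s∈ | inj₂ (there (here refl)) = λ ()
  extend-proper proper s s∈ | inj₂ (there (there (here refl))) = λ ()
  extend-proper proper s s∈ | inj₂ (there (there (there s∈fans))) with ∈-map⁻ fan s∈fans
  ... | i , _ , refl = λ { (c≡0 , c≡1 , _) → 0≢1 (trans (sym c≡0) c≡1) }
    where
    0≢1 : zero ≢ suc zero
    0≢1 ()

  extendSystem : ParityColouredSystem (2 + m) → ParityColouredSystem (5 + m)
  extendSystem (B , isSys , proper) =
    extend B , extend-isStarSystem {B} isSys , extend-proper {B} proper

open Extension using (extendSystem)

-- Admissibility passes unchanged to k, since (9 + k) % 3 reduces to (6 + k) % 3.
systemOfOrder6+ : ∀ k → (6 + k) % 3 ≡ 0 ⊎ (6 + k) % 3 ≡ 1 → ParityColouredSystem (6 + k)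
systemOfOrder6+ 0 _ = system₆
systemOfOrder6+ 1 _ = system₇
systemOfOrder6+ 2 (inj₁ ())
systemOfOrder6+ 2 (inj₂ ())
systemOfOrder6+ (suc (suc (suc k))) admissible = extendSystem (systemOfOrder6+ k admissible)

theorem2p1 : (n : ℕ) → 6 ≤ n → (n % 3 ≡ 0 ⊎ n % 3 ≡ 1) →
    Σ (List (Star3 n)) (λ B → IsStarSystem n B × EquitablyChromatic 2 B)
theorem2p1 _ (s≤s (s≤s (s≤s (s≤s (s≤s (s≤s {n = k} z≤n)))))) admissible
  with systemOfOrder6+ k admissible
... | B , isStarSystem , proper =
  B , isStarSystem , ((parity , proper) , starSystem⇒¬1-colourable isStarSystem)
    , parity , proper , parity-equitable (6 + k)
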